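{- Let $k\ge2$, $n_1,\ldots,n_k\ge2$, and let $x=x_1\cdots x_k$ and $y=y_1\cdots y_k$ be vertices of $H_{n_1,\ldots,n_k}$ with no common suffix (i.e. $x_k\neq y_k$). Let $u$ and $v$ be the maximal uniform suffixes of $x$ and $y$, respectively, and let $x'=x_1\cdots x_{k-1}$ and $y'=y_1\cdots y_{k-1}$. Then: (i) if $x_k=0$ or $y_k=0$, then $\mathrm{dist}(x,y)=\mathrm{alt}(x)+\mathrm{alt}(y)$; (ii) if $x_k,y_k\neq0$ and $|u|,|v|>1$, then $\mathrm{dist}(x,y)=\mathrm{alt}(x)+\mathrm{alt}(y)$; (iii) if $x_k,y_k\neq 0$ and either $|u|=1$ or $|v|=1$, then $\mathrm{dist}(x,y)=\mathrm{alt}(x')+\mathrm{alt}(y')+1$.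
   Context: For integers $n_1,\ldots,n_k\ge 2$, $H_{n_1,\ldots,n_k}$ is the simple graph on the strings $x=x_1\cdots x_k$ with $x_i\in\mathbb{Z}_{n_i}=\{0,\ldots,n_i-1\}$, where, writing $0^m$ for $m$ zeros and $w$ for a possibly empty common suffix, two distinct vertices are adjacent iff: (A0) $x=a\,w$, $y=b\,w$ with $a\neq b$; or (A1) for some $1\le m\le k$, $x=0^m w$ and $y=c_1\cdots c_m w$ with all $c_j\neq0$, or vice versa; or (A2) for some $1\le i\le k$, $x=0^{i-1}a\,w$, $y=0^{i-1}b\,w$ with $a,b\neq 0$, $a\ne b$. For any string $z=z_1\cdots z_\ell$, the alternating number $\mathrm{alt}(z)$ is the number of indices $j\in\{1,\ldots,\ell\}$ such that exactly one of $z_j,z_{j+1}$ is $0$, with $z_{\ell+1}:=0$. A string is uniform if its entries are all zero or all nonzero; the maximal uniform suffix of $x$ is the longest suffix of $x$ that is uniform, and $|u|$ denotes the length of a string $u$. $\mathrm{dist}$ is the graph distance in $H_{n_1,\ldots,n_k}$. -}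

module Defs where

open import Data.Nat using (ℕ; zero; suc; _+_; _≤_)
open import Data.Fin using (Fin; toℕ)
open import Data.Bool using (Bool; true; false; if_then_else_; _∧_; not; _xor_)
open import Data.List using (List; []; _∷_; length)
open import Data.Product using (Σ; _×_; ∃)
open import Data.Sum using (_⊎_)
open import Relation.Binary.PropositionalEquality using (_≡_; _≢_)
open import Relation.Nullary using (¬_)

-- A vertex of H_{n_1,...,n_k}: a string x_1 ... x_k with x_i ∈ Z_{n_i}.
-- Position i ∈ Fin k (0-based) stands for the paper's index i+1.
Vertex : (k : ℕ) → (Fin k → ℕ) → Set
Vertex k n = (i : Fin k) → Fin (n i)

Zero : ∀ {k n} → Vertex k n → Fin k → Set
Zero x i = toℕ (x i) ≡ 0

NonZero' : ∀ {k n} → Vertex k n → Fin k → Set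
NonZero' x i = toℕ (x i) ≢ 0

AgreeFrom : ∀ {k n} → ℕ → Vertex k n → Vertex k n → Set
AgreeFrom p x y = ∀ i → p ≤ toℕ i → x i ≡ y i

Distinct : ∀ {k n} → Vertex k n → Vertex k n → Set
Distinct x y = ∃ λ i → x i ≢ y i

-- (A0) x = a w, y = b w with a ≠ b.
A0 : ∀ {k n} → Vertex k n → Vertex k n → Set
A0 x y = Σ _ λ i → toℕ i ≡ 0 × x i ≢ y i × AgreeFrom 1 x y

-- (A1) for some 1 ≤ m ≤ k, x = 0^m w and y = c_1 ... c_m w with all c_j ≠ 0.
A1 : ∀ {k n} → Vertex k n → Vertex k n → Set
A1 {k} x y = Σ ℕ λ m → 1 ≤ m × m ≤ k ×
  ((∀ i → suc (toℕ i) ≤ m → Zero x i × NonZero' y i) × AgreeFrom m x y)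

-- (A2) for some 1 ≤ i ≤ k, x = 0^{i-1} a w, y = 0^{i-1} b w, a,b ≠ 0, a ≠ b.
-- Here j is the 0-based position of a, b (j = i - 1).
A2 : ∀ {k n} → Vertex k n → Vertex k n → Set
A2 x y = Σ _ λ j →
  (∀ i → suc (toℕ i) ≤ toℕ j → Zero x i × Zero y i) ×
  NonZero' x j × NonZero' y j × x j ≢ y j × AgreeFrom (suc (toℕ j)) x y

Adj : ∀ {k n} → Vertex k n → Vertex k n → Set
Adj x y = Distinct x y × (A0 x y ⊎ (A1 x y ⊎ A1 y x) ⊎ A2 x y)

data Walk {A : Set} (R : A → A → Set) : A → A → ℕ → Set where
  nil  : ∀ {x} → Walk R x x 0
  cons : ∀ {x y z ℓ} → R x y → Walk R y z ℓ → Walk R x z (suc ℓ)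

Dist : ∀ {A : Set} → (A → A → Set) → A → A → ℕ → Set
Dist R x y d = Walk R x y d × (∀ ℓ → Walk R x y ℓ → d ≤ ℓ)

-- Strings are handled through their zero pattern: true = entry is 0.
isZeroB : ∀ {m} → Fin m → Bool
isZeroB i with toℕ i
... | zero  = true
... | suc _ = false

-- alt(z): number of j ∈ {1..ℓ} such that exactly one of z_j, z_{j+1} is 0,
-- with z_{ℓ+1} := 0.
alt : List Bool → ℕ
alt []            = 0
alt (b ∷ [])      = if b xor true then 1 else 0
alt (b ∷ c ∷ bs)  = (if b xor c then 1 else 0) + alt (c ∷ bs)

allSame : Bool → List Bool → Bool
allSame b []       = true
allSame b (c ∷ cs) = not (b xor c) ∧ allSame b cs

uniform : List Bool → Bool
uniform []       = true
uniform (b ∷ bs) = allSame b bs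

maxUnifSuffixLen : List Bool → ℕ
maxUnifSuffixLen []       = 0
maxUnifSuffixLen (b ∷ bs) = if uniform (b ∷ bs) then length (b ∷ bs) else maxUnifSuffixLen bs

zeroPattern : ∀ {k n} → Vertex k n → List Bool
zeroPattern {k} x = Data.List.tabulate (λ i → isZeroB (x i))

module Submission where

-- alt x counts the A1-moves needed to reach 0^k: flipping the maximal uniform first block is an A1-move
-- lowering alt by one, and no move changes alt by more than one. A move turning a zero last entry into a
-- nonzero one must start at 0^k, and a move between two distinct nonzero last entries joins 0^{k-1}a and
-- 0^{k-1}b, where alt x' vanishes; among vertices with nonzero last entry alt x' is 1-Lipschitz as well. So a
-- walk either passes a vertex with zero last entry, costing alt x + alt y, or changes its nonzero last entry,
-- costing alt x' + alt y' + 1; both are realised. For x_k ≠ 0, alt x = alt x' + 2 if x_{k-1} = 0 (|u| = 1)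
-- and alt x = alt x' otherwise.

open import Defs
open import Data.Bool using (Bool; true; false; if_then_else_; not; _xor_)
open import Data.Bool.Properties using (∧-zeroʳ; xor-same; not-distribʳ-xor; ¬-not)
open import Data.Empty using (⊥-elim)
open import Data.Fin using (Fin; toℕ; fromℕ; fromℕ<; inject₁; inject≤) renaming (zero to fzero; suc to fsuc)
open import Data.Fin.Properties
  using (toℕ-injective; toℕ<n; toℕ-fromℕ; toℕ-fromℕ<; fromℕ<-toℕ; toℕ-inject₁; toℕ-inject≤; inject≤-refl)
open import Data.List using (List; []; _∷_; _++_; tabulate)
open import Data.List.Properties using (length-++; ++-assoc)
open import Data.Nat using (ℕ; zero; suc; pred; _+_; _⊓_; _≤_; _<_; z≤n; s≤s; _≤?_; _<?_)
open import Data.Nat.Properties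
open import Data.Product using (Σ; _×_; _,_; proj₁; proj₂; swap)
open import Data.Sum using (_⊎_; inj₁; inj₂; [_,_]′)
open import Function using (_∘_)
open import Relation.Binary.Definitions using (Symmetric; _Respects₂_; tri<; tri≈; tri>)
open import Relation.Binary.PropositionalEquality
open import Relation.Nullary using (¬_; yes; no)
open import Relation.Nullary.Decidable using (¬?; decidable-stable)
open import Relation.Unary using (Decidable)
import Data.Bool
import Data.Fin

module _ {A : Set} where

  private variable
    R S : A → A → Set
    P : A → Set
    x y z : A
    ℓ ℓ′ : ℕ

  walk-map : (∀ {u v} → R u v → S u v) → Walk R x y ℓ → Walk S x y ℓ
  walk-map f nil        = nil
  walk-map f (cons r w) = cons (f r) (walk-map f w)

  walk-++ : Walk R x y ℓ → Walk R y z ℓ′ → Walk R x z (ℓ + ℓ′)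
  walk-++ nil        w′ = w′
  walk-++ (cons r w) w′ = cons r (walk-++ w w′)

  walk-snoc : Walk R x y ℓ → R y z → Walk R x z (suc ℓ)
  walk-snoc nil         r = cons r nil
  walk-snoc (cons r′ w) r = cons r′ (walk-snoc w r)

  walk-reverse : Symmetric R → Walk R x y ℓ → Walk R y x ℓ
  walk-reverse sym nil        = nil
  walk-reverse sym (cons r w) = walk-snoc (walk-reverse sym w) (sym r)

  walk-lipschitz : (f : A → ℕ) → (∀ {u v} → R u v → f u ≤ suc (f v)) →
    Walk R x y ℓ → f x ≤ ℓ + f y
  walk-lipschitz f lip nil        = ≤-refl
  walk-lipschitz f lip (cons r w) = ≤-trans (lip r) (s≤s (walk-lipschitz f lip w))

  Within : (A → Set) → (A → A → Set) → A → A → Set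
  Within P R u v = P u × R u v × P v

  within-symmetric : Symmetric R → Symmetric (Within P R)
  within-symmetric sym (pu , r , pv) = pv , sym r , pu

  within-forget : Walk (Within P R) x y ℓ → Walk R x y ℓ
  within-forget = walk-map (proj₁ ∘ proj₂)

  within-target : P x → Walk (Within P R) x y ℓ → P y
  within-target px nil                 = px
  within-target px (cons (_ , _ , p) w) = within-target p w

  record Exit (P : A → Set) (R : A → A → Set) (x y : A) (ℓ : ℕ) : Set where
    field
      {inner outer} : A
      {t s}         : ℕ
      prefix        : Walk (Within P R) x inner t
      edge          : R inner outer
      outside       : ¬ P outer
      suffix        : Walk R outer y s
      length        : t + suc s ≡ ℓ

  first-exit : Decidable P → P x → Walk R x y ℓ →
    Walk (Within P R) x y ℓ ⊎ Exit P R x y ℓ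
  first-exit P? px nil = inj₁ nil
  first-exit P? px (cons {y = x₁} r w) with P? x₁
  ... | no ¬p = inj₂ (record { prefix = nil ; edge = r ; outside = ¬p ; suffix = w ; length = refl })
  ... | yes p with first-exit P? p w
  ...   | inj₁ w′ = inj₁ (cons (px , r , p) w′)
  ...   | inj₂ e  = inj₂ (record
          { prefix = cons (px , r , p) (Exit.prefix e) ; edge = Exit.edge e ; outside = Exit.outside e
          ; suffix = Exit.suffix e ; length = cong suc (Exit.length e) })

  module _ {_≈_ : A → A → Set} (≈-sym : Symmetric _≈_) (resp : R Respects₂ _≈_) where

    walk-end-resp : ∀ {y′} → y ≈ y′ → Walk R x y (suc ℓ) → Walk R x y′ (suc ℓ)
    walk-end-resp eq (cons r nil)          = cons (proj₁ resp eq r) nil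
    walk-end-resp eq (cons r w@(cons _ _)) = cons r (walk-end-resp eq w)

    walk-join : ∀ {u v} → ¬ x ≈ y → Walk R x u ℓ → u ≈ v → Walk R v y ℓ′ →
      Walk R x y (ℓ + ℓ′)
    walk-join x≉y nil        u≈v nil         = ⊥-elim (x≉y u≈v)
    walk-join {ℓ = suc ℓ} x≉y w@(cons _ _) u≈v nil
      rewrite +-identityʳ ℓ = walk-end-resp u≈v w
    walk-join x≉y w u≈v (cons r w′) = walk-++ w (cons (proj₂ resp (≈-sym u≈v) r) w′)

change : (ℕ → Bool) → ℕ → ℕ
change g j = if g j xor g (suc j) then 1 else 0

alternations : ℕ → (ℕ → Bool) → ℕ
alternations zero    g = 0
alternations (suc p) g = change g 0 + alternations p (g ∘ suc)

-- Padding with true (entry 0) implements the convention z_{ℓ+1} := 0 of alt.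
pad : ∀ {p} → (Fin p → Bool) → ℕ → Bool
pad {zero}  f j       = true
pad {suc p} f zero    = f fzero
pad {suc p} f (suc j) = pad (f ∘ fsuc) j

alt-tabulate : ∀ p (f : Fin p → Bool) → alt (tabulate f) ≡ alternations p (pad f)
alt-tabulate zero          f = refl
alt-tabulate (suc zero)    f = sym (+-identityʳ _)
alt-tabulate (suc (suc p)) f = cong (change (pad f) 0 +_) (alt-tabulate (suc p) (f ∘ fsuc))

pad-cong : ∀ {p} {f f′ : Fin p → Bool} → (∀ i → f i ≡ f′ i) → ∀ j → pad f j ≡ pad f′ j
pad-cong {zero}  eq j       = refl
pad-cong {suc p} eq zero    = eq fzero
pad-cong {suc p} eq (suc j) = pad-cong (eq ∘ fsuc) j

pad-toℕ : ∀ {p} (f : Fin p → Bool) i → pad f (toℕ i) ≡ f i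
pad-toℕ f fzero    = refl
pad-toℕ f (fsuc i) = pad-toℕ (f ∘ fsuc) i

pad-beyond : ∀ {p} (f : Fin p → Bool) j → p ≤ j → pad f j ≡ true
pad-beyond {zero}  f j       _         = refl
pad-beyond {suc p} f (suc j) (s≤s p≤j) = pad-beyond (f ∘ fsuc) j p≤j

pad-fromℕ< : ∀ {p} (f : Fin p → Bool) j (j<p : j < p) → pad f j ≡ f (fromℕ< j<p)
pad-fromℕ< f j j<p = subst (λ i → pad f i ≡ f (fromℕ< j<p)) (toℕ-fromℕ< j<p) (pad-toℕ f (fromℕ< j<p))

module _ where

  private variable
    g g′ : ℕ → Bool
    p q : ℕ
    b b′ : Bool

  change≤1 : ∀ g j → change g j ≤ 1
  change≤1 g j with g j xor g (suc j)
  ... | true  = ≤-refl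
  ... | false = z≤n

  alternations-cong : ∀ p → (∀ j → change g j ≡ change g′ j) → alternations p g ≡ alternations p g′
  alternations-cong zero    eq = refl
  alternations-cong (suc p) eq = cong₂ _+_ (eq 0) (alternations-cong p (eq ∘ suc))

  alternations-pointwise : ∀ p → (∀ j → g j ≡ g′ j) → alternations p g ≡ alternations p g′
  alternations-pointwise p eq =
    alternations-cong p λ j → cong₂ (λ a b → if a xor b then 1 else 0) (eq j) (eq (suc j))

  alternations-≤-suc : ∀ p d → (∀ j → j ≢ d → change g j ≡ change g′ j) →
    alternations p g ≤ suc (alternations p g′)
  alternations-≤-suc zero d eq = z≤n
  alternations-≤-suc {g} {g′} (suc p) zero eq = begin
    change g 0 + alternations p (g ∘ suc)
      ≡⟨ cong (change g 0 +_) (alternations-cong p (λ j → eq (suc j) λ ())) ⟩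
    change g 0 + alternations p (g′ ∘ suc)  ≤⟨ +-monoˡ-≤ _ (change≤1 g 0) ⟩
    suc (alternations p (g′ ∘ suc))          ≤⟨ s≤s (m≤n+m _ _) ⟩
    suc (change g′ 0 + alternations p (g′ ∘ suc)) ∎
    where open ≤-Reasoning
  alternations-≤-suc {g} {g′} (suc p) (suc d) eq = begin
    change g 0 + alternations p (g ∘ suc)        ≡⟨ cong (_+ _) (eq 0 λ ()) ⟩
    change g′ 0 + alternations p (g ∘ suc)
      ≤⟨ +-monoʳ-≤ (change g′ 0) (alternations-≤-suc p d λ j j≢d → eq (suc j) (j≢d ∘ suc-injective)) ⟩
    change g′ 0 + suc (alternations p (g′ ∘ suc)) ≡⟨ +-suc _ _ ⟩
    suc (change g′ 0 + alternations p (g′ ∘ suc)) ∎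
    where open ≤-Reasoning

  alternations-drop : ∀ p d → d < p → (∀ j → j ≢ d → change g j ≡ change g′ j) →
    change g d ≡ 1 → change g′ d ≡ 0 → alternations p g ≡ suc (alternations p g′)
  alternations-drop (suc p) zero _ eq g₁ g′₀ rewrite g₁ | g′₀ =
    cong suc (alternations-cong p (λ j → eq (suc j) λ ()))
  alternations-drop {g} {g′} (suc p) (suc d) (s≤s d<p) eq g₁ g′₀ = begin
    change g 0 + alternations p (g ∘ suc)         ≡⟨ cong₂ _+_ (eq 0 λ ())
      (alternations-drop p d d<p (λ j j≢d → eq (suc j) (j≢d ∘ suc-injective)) g₁ g′₀) ⟩
    change g′ 0 + suc (alternations p (g′ ∘ suc)) ≡⟨ +-suc _ _ ⟩
    suc (change g′ 0 + alternations p (g′ ∘ suc)) ∎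
    where open ≡-Reasoning

  alternations-const : ∀ p → (∀ j → j ≤ p → g j ≡ b) → alternations p g ≡ 0
  alternations-const zero    const = refl
  alternations-const {g} {b} (suc p) const
    rewrite const 0 z≤n | const 1 (s≤s z≤n) | xor-same b =
      alternations-const p (λ j j≤p → const (suc j) (s≤s j≤p))

  alternations-zero : ∀ p → alternations p g ≡ 0 → ∀ j → j ≤ p → g j ≡ g p
  alternations-zero zero    eq zero    z≤n       = refl
  alternations-zero {g} (suc p) eq zero z≤n with g 0 xor g 1 in g₀g₁
  ... | false = trans (xor-false g₀g₁) (alternations-zero p eq 0 z≤n)
    where
    xor-false : ∀ {a b} → a xor b ≡ false → a ≡ b
    xor-false {false} {false} _ = refl
    xor-false {true}  {true}  _ = refl
  alternations-zero {g} (suc p) eq (suc j) (s≤s j≤p) =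
    alternations-zero p (m+n≡0⇒n≡0 (change g 0) eq) j j≤p

  first-change : ∀ p a → alternations p g ≡ suc a →
    Σ ℕ λ q → suc q ≤ p × (∀ j → j < suc q → g j ≡ g 0) × g (suc q) ≢ g 0
  first-change {g} p a eq with constant-or-change p
    where
    constant-or-change : ∀ p → (∀ j → j ≤ p → g j ≡ g 0) ⊎
      (Σ ℕ λ q → suc q ≤ p × (∀ j → j < suc q → g j ≡ g 0) × g (suc q) ≢ g 0)
    constant-or-change zero = inj₁ λ { zero z≤n → refl }
    constant-or-change (suc p) with constant-or-change p
    ... | inj₂ (q , q<p , const , g≢) = inj₂ (q , m≤n⇒m≤1+n q<p , const , g≢)
    ... | inj₁ const with g (suc p) Data.Bool.≟ g 0
    ...   | no g≢  = inj₂ (p , ≤-refl , (λ j j<1+p → const j (<⇒≤pred j<1+p)) , g≢)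
    ...   | yes g≡ = inj₁ λ j j≤1+p → [ (λ j<1+p → const j (<⇒≤pred j<1+p)) , (λ { refl → g≡ }) ]′
                                       (m≤n⇒m<n∨m≡n j≤1+p)
  ... | inj₁ const  = ⊥-elim (0≢1+n (trans (sym (alternations-const p const)) eq))
  ... | inj₂ change = change

  change-outside-block : ∀ q → (∀ j → j < q → g j ≡ b) → (∀ j → j < q → g′ j ≡ b′) →
    (∀ j → q ≤ j → g j ≡ g′ j) → ∀ j → suc j ≢ q → change g j ≡ change g′ j
  change-outside-block {b = b} {b′ = b′} q const const′ agree j 1+j≢q with q ≤? j
  ... | yes q≤j rewrite agree j q≤j | agree (suc j) (m≤n⇒m≤1+n q≤j) = refl
  ... | no q≰j with m≤n⇒m<n∨m≡n (≰⇒> q≰j)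
  ...   | inj₂ 1+j≡q = ⊥-elim (1+j≢q 1+j≡q)
  ...   | inj₁ 1+j<q rewrite const j (≰⇒> q≰j) | const (suc j) 1+j<q
                           | const′ j (≰⇒> q≰j) | const′ (suc j) 1+j<q | xor-same b | xor-same b′ = refl

  alternations-swap-block : ∀ p q → (∀ j → j < q → g j ≡ b) → (∀ j → j < q → g′ j ≡ b′) →
    (∀ j → q ≤ j → g j ≡ g′ j) → alternations p g ≤ suc (alternations p g′)
  alternations-swap-block p q const const′ agree = alternations-≤-suc p (pred q)
    λ j j≢q-1 → change-outside-block q const const′ agree j (j≢q-1 ∘ cong pred)

  alternations-flip-block : ∀ p q → suc q ≤ p → (∀ j → j < suc q → g j ≡ b) → g (suc q) ≢ b →
    (∀ j → j < suc q → g′ j ≡ not b) → (∀ j → suc q ≤ j → g j ≡ g′ j) →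
    alternations p g ≡ suc (alternations p g′)
  alternations-flip-block {g} {b} {g′} p q q<p const g≢b const′ agree =
    alternations-drop p q q<p (λ j j≢q → change-outside-block (suc q) const const′ agree j (j≢q ∘ suc-injective))
      changes unchanged
    where
    changes : change g q ≡ 1
    changes rewrite const q ≤-refl | ¬-not g≢b | sym (not-distribʳ-xor b b) | xor-same b = refl
    unchanged : change g′ q ≡ 0
    unchanged rewrite const′ q ≤-refl | sym (agree (suc q) ≤-refl) | ¬-not g≢b | xor-same (not b) = refl

alt-snoc-false : ∀ l a → alt (l ++ a ∷ false ∷ []) ≡ alt (l ++ a ∷ []) + (if a then 2 else 0)
alt-snoc-false []          true  = refl
alt-snoc-false []          false = refl
alt-snoc-false (c ∷ [])    a     = trans (cong (δ +_) (alt-snoc-false [] a)) (sym (+-assoc δ _ _))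
  where
  δ : ℕ
  δ = if c xor a then 1 else 0
alt-snoc-false (c ∷ d ∷ l) a     = trans (cong (δ +_) (alt-snoc-false (d ∷ l) a)) (sym (+-assoc δ _ _))
  where
  δ : ℕ
  δ = if c xor d then 1 else 0

allSame-true-false : ∀ c l → allSame c (l ++ true ∷ false ∷ []) ≡ false
allSame-true-false true  []      = refl
allSame-true-false false []      = refl
allSame-true-false c     (d ∷ l) rewrite allSame-true-false c l = ∧-zeroʳ _

maxUnifSuffixLen-true-false : ∀ l → maxUnifSuffixLen (l ++ true ∷ false ∷ []) ≡ 1
maxUnifSuffixLen-true-false []      = refl
maxUnifSuffixLen-true-false (c ∷ l) rewrite allSame-true-false c l = maxUnifSuffixLen-true-false l

maxUnifSuffixLen-false-false : ∀ l → 2 ≤ maxUnifSuffixLen (l ++ false ∷ false ∷ [])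
maxUnifSuffixLen-false-false []      = ≤-refl
maxUnifSuffixLen-false-false (c ∷ l) with allSame c (l ++ false ∷ false ∷ [])
... | true  = s≤s (subst (1 ≤_) (sym (length-++ l)) (≤-trans (s≤s z≤n) (m≤n+m 2 _)))
... | false = maxUnifSuffixLen-false-false l

tabulate-snoc : ∀ {A : Set} p (f : Fin (suc p) → A) → tabulate f ≡ tabulate (f ∘ inject₁) ++ f (fromℕ p) ∷ []
tabulate-snoc zero    f = refl
tabulate-snoc (suc p) f = cong (f fzero ∷_) (tabulate-snoc p (f ∘ fsuc))

isZeroB-zero : ∀ {p} (a : Fin p) → toℕ a ≡ 0 → isZeroB a ≡ true
isZeroB-zero a eq with toℕ a
... | zero = refl

isZeroB-nonzero : ∀ {p} (a : Fin p) → toℕ a ≢ 0 → isZeroB a ≡ false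
isZeroB-nonzero a ne with toℕ a
... | zero  = ⊥-elim (ne refl)
... | suc _ = refl

isZeroB-true : ∀ {p} (a : Fin p) → isZeroB a ≡ true → toℕ a ≡ 0
isZeroB-true a eq with toℕ a
... | zero = refl

isZeroB-false : ∀ {p} (a : Fin p) → isZeroB a ≡ false → toℕ a ≢ 0
isZeroB-false a eq with toℕ a
... | suc _ = λ ()

zero-unique : ∀ {p} {a b : Fin p} → toℕ a ≡ 0 → toℕ b ≡ 0 → a ≡ b
zero-unique a≡0 b≡0 = toℕ-injective (trans a≡0 (sym b≡0))

uniform-suffix-one⇒true : ∀ l a → maxUnifSuffixLen (l ++ a ∷ false ∷ []) ≡ 1 → a ≡ true
uniform-suffix-one⇒true l true  _   = refl
uniform-suffix-one⇒true l false one = ⊥-elim (<-irrefl refl (subst (1 <_) one (maxUnifSuffixLen-false-false l)))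

uniform-suffix-long⇒false : ∀ l a → 1 < maxUnifSuffixLen (l ++ a ∷ false ∷ []) → a ≡ false
uniform-suffix-long⇒false l false _    = refl
uniform-suffix-long⇒false l true  long = ⊥-elim (<-irrefl refl (subst (1 <_) (maxUnifSuffixLen-true-false l) long))

module _ {m : ℕ} {n : Fin (suc (suc m)) → ℕ} (x : Vertex (suc (suc m)) n) (x≢0 : NonZero' x (fromℕ (suc m))) where

  private
    front : List Bool
    front = zeroPattern (x ∘ inject₁ ∘ inject₁)

    penultimate : Bool
    penultimate = isZeroB (x (inject₁ (fromℕ m)))

    zeroPattern-init : zeroPattern (x ∘ inject₁) ≡ front ++ penultimate ∷ []
    zeroPattern-init = tabulate-snoc m (isZeroB ∘ x ∘ inject₁)

    zeroPattern-full : zeroPattern x ≡ front ++ penultimate ∷ false ∷ []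
    zeroPattern-full = begin
      zeroPattern x
        ≡⟨ tabulate-snoc (suc m) (isZeroB ∘ x) ⟩
      zeroPattern (x ∘ inject₁) ++ isZeroB (x (fromℕ (suc m))) ∷ []
        ≡⟨ cong₂ (λ l b → l ++ b ∷ []) zeroPattern-init (isZeroB-nonzero _ x≢0) ⟩
      (front ++ penultimate ∷ []) ++ false ∷ []
        ≡⟨ ++-assoc front (penultimate ∷ []) (false ∷ []) ⟩
      front ++ penultimate ∷ false ∷ [] ∎
      where open ≡-Reasoning

    alt-by-penultimate : ∀ b → penultimate ≡ b →
      alt (zeroPattern x) ≡ alt (zeroPattern (x ∘ inject₁)) + (if b then 2 else 0)
    alt-by-penultimate b refl = begin
      alt (zeroPattern x)                          ≡⟨ cong alt zeroPattern-full ⟩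
      alt (front ++ penultimate ∷ false ∷ [])      ≡⟨ alt-snoc-false front penultimate ⟩
      alt (front ++ penultimate ∷ []) + bonus      ≡⟨ cong (λ l → alt l + bonus) (sym zeroPattern-init) ⟩
      alt (zeroPattern (x ∘ inject₁)) + bonus      ∎
      where
      bonus : ℕ
      bonus = if penultimate then 2 else 0
      open ≡-Reasoning

  alt-init-≤ : alt (zeroPattern (x ∘ inject₁)) ≤ alt (zeroPattern x)
  alt-init-≤ = subst (alt (zeroPattern (x ∘ inject₁)) ≤_) (sym (alt-by-penultimate penultimate refl)) (m≤m+n _ _)

  alt-long-uniform-suffix : 1 < maxUnifSuffixLen (zeroPattern x) →
    alt (zeroPattern x) ≡ alt (zeroPattern (x ∘ inject₁))
  alt-long-uniform-suffix long = trans (alt-by-penultimate false penultimate-nonzero) (+-identityʳ _)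
    where
    penultimate-nonzero : penultimate ≡ false
    penultimate-nonzero = uniform-suffix-long⇒false front penultimate
      (subst (λ l → 1 < maxUnifSuffixLen l) zeroPattern-full long)

  alt-short-uniform-suffix : maxUnifSuffixLen (zeroPattern x) ≡ 1 →
    alt (zeroPattern x) ≡ 2 + alt (zeroPattern (x ∘ inject₁))
  alt-short-uniform-suffix one = trans (alt-by-penultimate true penultimate-zero) (+-comm _ 2)
    where
    penultimate-zero : penultimate ≡ true
    penultimate-zero = uniform-suffix-one⇒true front penultimate
      (trans (cong maxUnifSuffixLen (sym zeroPattern-full)) one)

module Graph (m : ℕ) (1≤m : 1 ≤ m) (n : Fin (suc m) → ℕ) (2≤n : ∀ i → 2 ≤ n i) where

  V : Set
  V = Vertex (suc m) n

  private variable
    x y : V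
    q ℓ : ℕ

  last : Fin (suc m)
  last = fromℕ m

  ZeroLast NonZeroLast : V → Set
  ZeroLast x    = Zero x last
  NonZeroLast x = NonZero' x last

  _≈_ : V → V → Set
  x ≈ y = ∀ i → x i ≡ y i

  ≈-sym : Symmetric _≈_
  ≈-sym eq i = sym (eq i)

  Move : V → V → Set
  Move x y = A0 x y ⊎ (A1 x y ⊎ A1 y x) ⊎ A2 x y

  Adj-sym : Symmetric (Adj {n = n})
  Adj-sym {x} {y} ((i , x≢y) , move) = (i , x≢y ∘ sym) , flip-move move
    where
    flip-move : Move x y → Move y x
    flip-move (inj₁ (i , i≡0 , x≢y , agree)) = inj₁ (i , i≡0 , x≢y ∘ sym , λ j h → sym (agree j h))
    flip-move (inj₂ (inj₁ (inj₁ a))) = inj₂ (inj₁ (inj₂ a))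
    flip-move (inj₂ (inj₁ (inj₂ a))) = inj₂ (inj₁ (inj₁ a))
    flip-move (inj₂ (inj₂ (j , zeros , x≢0 , y≢0 , x≢y , agree))) =
      inj₂ (inj₂ (j , (λ i h → swap (zeros i h)) , y≢0 , x≢0 , x≢y ∘ sym , λ i h → sym (agree i h)))

  Adj-respˡ : ∀ {x x′ y} → x ≈ x′ → Adj x y → Adj x′ y
  Adj-respˡ {x} {x′} {y} eq ((i , x≢y) , move) = (i , λ e → x≢y (trans (eq i) e)) , transport move
    where
    zero′ : ∀ {i} → Zero x i → Zero x′ i
    zero′ {i} z = trans (cong toℕ (sym (eq i))) z
    nonzero′ : ∀ {i} → NonZero' x i → NonZero' x′ i
    nonzero′ {i} nz e = nz (trans (cong toℕ (eq i)) e)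
    agree′ : ∀ {p} → AgreeFrom p x y → AgreeFrom p x′ y
    agree′ agree i h = trans (sym (eq i)) (agree i h)
    transport : Move x y → Move x′ y
    transport (inj₁ (i , i≡0 , x≢y , agree)) = inj₁ (i , i≡0 , (λ e → x≢y (trans (eq i) e)) , agree′ agree)
    transport (inj₂ (inj₁ (inj₁ (q , 1≤q , q≤k , block , agree)))) =
      inj₂ (inj₁ (inj₁ (q , 1≤q , q≤k , (λ i h → zero′ (proj₁ (block i h)) , proj₂ (block i h)) ,
        agree′ agree)))
    transport (inj₂ (inj₁ (inj₂ (q , 1≤q , q≤k , block , agree)))) =
      inj₂ (inj₁ (inj₂ (q , 1≤q , q≤k , (λ i h → proj₁ (block i h) , nonzero′ (proj₂ (block i h))) ,
        λ i h → trans (agree i h) (eq i))))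
    transport (inj₂ (inj₂ (j , zeros , x≢0 , y≢0 , x≢y , agree))) =
      inj₂ (inj₂ (j , (λ i h → zero′ (proj₁ (zeros i h)) , proj₂ (zeros i h)) , nonzero′ x≢0 , y≢0 ,
        (λ e → x≢y (trans (eq j) e)) , agree′ agree))

  Adj-resp : (Adj {n = n}) Respects₂ _≈_
  Adj-resp = (λ eq a → Adj-sym (Adj-respˡ eq (Adj-sym a))) , Adj-respˡ

  fill : Bool → V
  fill true  i = fromℕ< (≤-trans (s≤s z≤n) (2≤n i))
  fill false i = fromℕ< (2≤n i)

  isZeroB-fill : ∀ b i → isZeroB (fill b i) ≡ b
  isZeroB-fill true  i = isZeroB-zero _ (toℕ-fromℕ< _)
  isZeroB-fill false i = isZeroB-nonzero _ λ e → 0≢1+n (trans (sym e) (toℕ-fromℕ< (2≤n i)))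

  splice : ℕ → V → V → V
  splice q c x i with toℕ i <? q
  ... | yes _ = c i
  ... | no  _ = x i

  splice-< : ∀ q c x i → toℕ i < q → splice q c x i ≡ c i
  splice-< q c x i i<q with toℕ i <? q
  ... | yes _   = refl
  ... | no  i≮q = ⊥-elim (i≮q i<q)

  splice-≥ : ∀ q c x i → q ≤ toℕ i → splice q c x i ≡ x i
  splice-≥ q c x i q≤i with toℕ i <? q
  ... | yes i<q = ⊥-elim (<⇒≱ i<q q≤i)
  ... | no  _   = refl

  block-adj : 1 ≤ q → q ≤ suc m → (∀ i → toℕ i < q → Zero x i × NonZero' y i) → AgreeFrom q x y →
    Adj x y
  block-adj {q} 1≤q q≤k block agree =
    (fzero , λ e → proj₂ (block fzero 1≤q) (trans (cong toℕ (sym e)) (proj₁ (block fzero 1≤q)))) ,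
    inj₂ (inj₁ (inj₁ (q , 1≤q , q≤k , block , agree)))

  block-flip-adj : ∀ b → 1 ≤ q → q ≤ suc m → (∀ i → toℕ i < q → isZeroB (x i) ≡ b) →
    Adj x (splice q (fill (not b)) x)
  block-flip-adj {q} {x} true 1≤q q≤k block = block-adj 1≤q q≤k
    (λ i h → isZeroB-true _ (block i h) ,
             isZeroB-false _ (trans (cong isZeroB (splice-< q _ x i h)) (isZeroB-fill false i)))
    (λ i h → sym (splice-≥ q _ x i h))
  block-flip-adj {q} {x} false 1≤q q≤k block = Adj-sym (block-adj 1≤q q≤k
    (λ i h → isZeroB-true _ (trans (cong isZeroB (splice-< q _ x i h)) (isZeroB-fill true i)) ,
             isZeroB-false _ (block i h))
    (λ i h → splice-≥ q _ x i h))

  module Prefix (p : ℕ) (p≤k : p ≤ suc m) where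

    profile : V → ℕ → Bool
    profile x = pad (λ i → isZeroB (x (inject≤ i p≤k)))

    altPrefix : V → ℕ
    altPrefix x = alternations p (profile x)

    position : ∀ {j} → j < p → Fin (suc m)
    position j<p = fromℕ< (<-≤-trans j<p p≤k)

    profile-index : ∀ x {j} (j<p : j < p) → profile x j ≡ isZeroB (x (position j<p))
    profile-index x {j} j<p = trans (pad-fromℕ< _ j j<p) (cong (isZeroB ∘ x) (toℕ-injective
      (trans (toℕ-inject≤ _ p≤k) (trans (toℕ-fromℕ< j<p) (sym (toℕ-fromℕ< _))))))

    profile-at : ∀ x i → toℕ i < p → profile x (toℕ i) ≡ isZeroB (x i)
    profile-at x i i<p = trans (profile-index x i<p) (cong (isZeroB ∘ x) (fromℕ<-toℕ i _))

    profile-beyond : ∀ x j → p ≤ j → profile x j ≡ true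
    profile-beyond x = pad-beyond _

    profile-agree : ∀ q → (∀ i → q ≤ toℕ i → isZeroB (x i) ≡ isZeroB (y i)) →
      ∀ j → q ≤ j → profile x j ≡ profile y j
    profile-agree {x} {y} q agree j q≤j with j <? p
    ... | yes j<p = trans (profile-index x j<p)
          (trans (agree _ (subst (q ≤_) (sym (toℕ-fromℕ< _)) q≤j)) (sym (profile-index y j<p)))
    ... | no  j≮p = trans (profile-beyond x j (≮⇒≥ j≮p)) (sym (profile-beyond y j (≮⇒≥ j≮p)))

    profile-block : ∀ {b} q → q ≤ p → (∀ i → toℕ i < q → isZeroB (x i) ≡ b) →
      ∀ j → j < q → profile x j ≡ b
    profile-block {x} q q≤p block j j<q =
      trans (profile-index x (<-≤-trans j<q q≤p)) (block _ (subst (_< q) (sym (toℕ-fromℕ< _)) j<q))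

    altPrefix-zero : ∀ x → (∀ i → toℕ i < p → Zero x i) → altPrefix x ≡ 0
    altPrefix-zero x zeros = alternations-const p λ j j≤p →
      [ profile-block p ≤-refl (λ i h → isZeroB-zero _ (zeros i h)) j
      , (λ { refl → profile-beyond x p ≤-refl }) ]′ (m≤n⇒m<n∨m≡n j≤p)

    -- An A1-move on a block reaching past p is not a block swap of the padded profile.
    ZeroPrefixWithin : V → Set
    ZeroPrefixWithin x = ∀ q → q ≤ suc m → (∀ i → toℕ i < q → Zero x i) → q ≤ p

    altPrefix-lipschitz : ZeroPrefixWithin x → ZeroPrefixWithin y → Adj x y → altPrefix x ≤ suc (altPrefix y)
    altPrefix-lipschitz {x} {y} _ _ (_ , inj₁ (_ , _ , _ , agree)) =
      alternations-swap-block p 1 (below-one (profile x)) (below-one (profile y))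
        (profile-agree 1 λ i h → cong isZeroB (agree i h))
      where
      below-one : ∀ g j → j < 1 → g j ≡ g 0
      below-one g zero    _         = refl
      below-one g (suc j) (s≤s ())
    altPrefix-lipschitz {x} {y} shortˣ _ (_ , inj₂ (inj₁ (inj₁ (q , _ , q≤k , block , agree)))) =
      alternations-swap-block p q
        (profile-block q q≤p λ i h → isZeroB-zero _ (proj₁ (block i h)))
        (profile-block q q≤p λ i h → isZeroB-nonzero _ (proj₂ (block i h)))
        (profile-agree q λ i h → cong isZeroB (agree i h))
      where
      q≤p : q ≤ p
      q≤p = shortˣ q q≤k λ i h → proj₁ (block i h)
    altPrefix-lipschitz {x} {y} _ shortʸ (_ , inj₂ (inj₁ (inj₂ (q , _ , q≤k , block , agree)))) =
      alternations-swap-block p q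
        (profile-block q q≤p λ i h → isZeroB-nonzero _ (proj₂ (block i h)))
        (profile-block q q≤p λ i h → isZeroB-zero _ (proj₁ (block i h)))
        (profile-agree q λ i h → cong isZeroB (sym (agree i h)))
      where
      q≤p : q ≤ p
      q≤p = shortʸ q q≤k λ i h → proj₁ (block i h)
    altPrefix-lipschitz {x} {y} _ _ (_ , inj₂ (inj₂ (j , zeros , x≢0 , y≢0 , _ , agree))) =
      alternations-swap-block {b = true} {b′ = true} p 0 (λ _ ()) (λ _ ()) (profile-agree 0 λ i _ → same-pattern i)
      where
      same-pattern : ∀ i → isZeroB (x i) ≡ isZeroB (y i)
      same-pattern i with <-cmp (toℕ i) (toℕ j)
      ... | tri< i<j _ _ = trans (isZeroB-zero _ (proj₁ (zeros i i<j))) (sym (isZeroB-zero _ (proj₂ (zeros i i<j))))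
      ... | tri≈ _ i≡j _ rewrite toℕ-injective i≡j = trans (isZeroB-nonzero _ x≢0) (sym (isZeroB-nonzero _ y≢0))
      ... | tri> _ _ j<i = cong isZeroB (agree i j<i)

    flip-first-block : ∀ {a} x → altPrefix x ≡ suc a → Σ V λ y → Adj x y × altPrefix y ≡ a × AgreeFrom p y x
    flip-first-block {a} x eq with first-change p a eq
    ... | q , q<p , const , changes =
      x₁ , block-flip-adj b (s≤s z≤n) (≤-trans q<p p≤k) x-block , suc-injective (trans (sym drop) eq) ,
      λ i h → splice-≥ _ _ x i (≤-trans q<p h)
      where
      b : Bool
      b = profile x 0
      x₁ : V
      x₁ = splice (suc q) (fill (not b)) x
      x-block : ∀ i → toℕ i < suc q → isZeroB (x i) ≡ b
      x-block i h = trans (sym (profile-at x i (<-≤-trans h q<p))) (const _ h)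
      drop : altPrefix x ≡ suc (altPrefix x₁)
      drop = alternations-flip-block p q q<p const changes
        (profile-block (suc q) q<p λ i h → trans (cong isZeroB (splice-< _ _ x i h)) (isZeroB-fill (not b) i))
        (profile-agree (suc q) λ i h → cong isZeroB (sym (splice-≥ _ _ x i h)))

    descend : ∀ x t → (∀ i → toℕ i < p → Zero t i) → AgreeFrom p t x →
      Σ V λ t′ → Walk Adj x t′ (altPrefix x) × t′ ≈ t
    descend x t zeros = go (altPrefix x) x refl
      where
      go : ∀ a x → altPrefix x ≡ a → AgreeFrom p t x → Σ V λ t′ → Walk Adj x t′ a × t′ ≈ t
      go zero x eq agree = x , nil , x≈t
        where
        x≈t : x ≈ t
        x≈t i with toℕ i <? p
        ... | yes i<p = zero-unique (isZeroB-true _ (trans (sym (profile-at x i i<p))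
                          (trans (alternations-zero p eq (toℕ i) (<⇒≤ i<p)) (profile-beyond x p ≤-refl))))
                          (zeros i i<p)
        ... | no  i≮p = sym (agree i (≮⇒≥ i≮p))
      go (suc a) x eq agree with flip-first-block x eq
      ... | y , x~y , eq′ , y≈x with go a y eq′ (λ i h → trans (agree i h) (sym (y≈x i h)))
      ...   | t′ , w , t′≈t = t′ , cons x~y w , t′≈t

  toℕ-last : toℕ last ≡ m
  toℕ-last = toℕ-fromℕ m

  agree-at-last : ∀ q → AgreeFrom q x y → q ≤ m → x last ≡ y last
  agree-at-last q agree q≤m = agree last (subst (q ≤_) (sym toℕ-last) q≤m)

  below-all : ¬ q ≤ m → ∀ (i : Fin (suc m)) → toℕ i < q
  below-all q≰m i = <-≤-trans (toℕ<n i) (≰⇒> q≰m)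

  last-move : Adj x y → x last ≢ y last →
      ((∀ i → toℕ i < m → Zero x i × Zero y i) × NonZeroLast x × NonZeroLast y)
    ⊎ (∀ i → Zero x i × NonZero' y i)
    ⊎ (∀ i → NonZero' x i × Zero y i)
  last-move (_ , inj₁ (_ , _ , _ , agree)) x≢y = ⊥-elim (x≢y (agree-at-last 1 agree 1≤m))
  last-move (_ , inj₂ (inj₁ (inj₁ (q , _ , _ , block , agree)))) x≢y with q ≤? m
  ... | yes q≤m = ⊥-elim (x≢y (agree-at-last q agree q≤m))
  ... | no  q≰m = inj₂ (inj₁ λ i → block i (below-all q≰m i))
  last-move (_ , inj₂ (inj₁ (inj₂ (q , _ , _ , block , agree)))) x≢y with q ≤? m
  ... | yes q≤m = ⊥-elim (x≢y (sym (agree-at-last q agree q≤m)))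
  ... | no  q≰m = inj₂ (inj₂ λ i → swap (block i (below-all q≰m i)))
  last-move {x} {y} (_ , inj₂ (inj₂ (j , zeros , x≢0 , y≢0 , _ , agree))) x≢y with suc (toℕ j) ≤? m
  ... | yes j<m = ⊥-elim (x≢y (agree-at-last _ agree j<m))
  ... | no  j≮m = inj₁ ((λ i i<m → zeros i (subst (toℕ i <_) (sym j≡m) i<m)) ,
                        subst (NonZero' x) j≡last x≢0 , subst (NonZero' y) j≡last y≢0)
    where
    j≡m : toℕ j ≡ m
    j≡m = ≤-antisym (<⇒≤pred (toℕ<n j)) (≮⇒≥ j≮m)
    j≡last : j ≡ last
    j≡last = toℕ-injective (trans j≡m (sym toℕ-last))

  zeroLast-move : Adj x y → ZeroLast x → NonZeroLast y → ∀ i → Zero x i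
  zeroLast-move adj x≡0 y≢0 with last-move adj (λ e → y≢0 (trans (cong toℕ (sym e)) x≡0))
  ... | inj₁ (_ , x≢0 , _) = ⊥-elim (x≢0 x≡0)
  ... | inj₂ (inj₁ block)  = proj₁ ∘ block
  ... | inj₂ (inj₂ block)  = ⊥-elim (proj₁ (block last) x≡0)

  nonzeroLast-move : Adj x y → NonZeroLast x → NonZeroLast y → x last ≢ y last →
    ∀ i → toℕ i < m → Zero x i × Zero y i
  nonzeroLast-move adj x≢0 y≢0 x≢y with last-move adj x≢y
  ... | inj₁ (zeros , _)  = zeros
  ... | inj₂ (inj₁ block) = ⊥-elim (x≢0 (proj₁ (block last)))
  ... | inj₂ (inj₂ block) = ⊥-elim (y≢0 (proj₂ (block last)))

  module Full = Prefix (suc m) ≤-refl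
  module Init = Prefix m (n≤1+n m)

  altFull altInit : V → ℕ
  altFull = Full.altPrefix
  altInit = Init.altPrefix

  altFull-lipschitz : Adj x y → altFull x ≤ suc (altFull y)
  altFull-lipschitz = Full.altPrefix-lipschitz (λ _ q≤k _ → q≤k) (λ _ q≤k _ → q≤k)

  altInit-lipschitz : Within NonZeroLast Adj x y → altInit x ≤ suc (altInit y)
  altInit-lipschitz (x≢0 , adj , y≢0) = Init.altPrefix-lipschitz (short x≢0) (short y≢0) adj
    where
    short : NonZeroLast x → Init.ZeroPrefixWithin x
    short x≢0 q _ zeros with q ≤? m
    ... | yes q≤m = q≤m
    ... | no  q≰m = ⊥-elim (x≢0 (zeros last (below-all q≰m last)))

  Adj-within-sym : Symmetric (Within NonZeroLast (Adj {n = n}))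
  Adj-within-sym = within-symmetric (λ {u} {v} → Adj-sym {u} {v})

  zeroLast? : Decidable ZeroLast
  zeroLast? x = toℕ (x last) ≟ 0

  nonzeroLast? : Decidable NonZeroLast
  nonzeroLast? x = ¬? (zeroLast? x)

  distance-bound-zero-nonzero : ZeroLast x → NonZeroLast y → Walk Adj x y ℓ → altFull x + altFull y ≤ ℓ
  distance-bound-zero-nonzero {x} {y} x≡0 y≢0 w with first-exit zeroLast? x≡0 w
  ... | inj₁ w′ = ⊥-elim (y≢0 (within-target x≡0 w′))
  ... | inj₂ e  = subst (_ ≤_) length (+-mono-≤ before after)
    where
    open Exit e
    inner-zero : altFull inner ≡ 0
    inner-zero = Full.altPrefix-zero inner λ i _ → zeroLast-move edge (within-target x≡0 prefix) outside i
    before : altFull x ≤ t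
    before = begin
      altFull x         ≤⟨ walk-lipschitz altFull altFull-lipschitz (within-forget prefix) ⟩
      t + altFull inner ≡⟨ cong (t +_) inner-zero ⟩
      t + 0             ≡⟨ +-identityʳ t ⟩
      t                 ∎
      where open ≤-Reasoning
    after : altFull y ≤ suc s
    after = begin
      altFull y               ≤⟨ walk-lipschitz altFull altFull-lipschitz (walk-reverse Adj-sym suffix) ⟩
      s + altFull outer       ≤⟨ +-monoʳ-≤ s (altFull-lipschitz (Adj-sym edge)) ⟩
      s + suc (altFull inner) ≡⟨ cong (λ a → s + suc a) inner-zero ⟩
      s + 1                   ≡⟨ +-comm s 1 ⟩
      suc s                   ∎
      where open ≤-Reasoning

  distance-bound-nonzero-zero : NonZeroLast x → ZeroLast y → Walk Adj x y ℓ → altFull x + altFull y ≤ ℓ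
  distance-bound-nonzero-zero {x = x} {y = y} {ℓ = ℓ} x≢0 y≡0 w =
    subst (_≤ ℓ) (+-comm (altFull y) (altFull x)) (distance-bound-zero-nonzero y≡0 x≢0 (walk-reverse Adj-sym w))

  distance-bound-nonzero : NonZeroLast x → NonZeroLast y → x last ≢ y last → Walk Adj x y ℓ →
    altFull x + altFull y ≤ ℓ ⊎ suc (altInit x + altInit y) ≤ ℓ
  distance-bound-nonzero {x} {y} x≢0 y≢0 x≢y w with first-exit nonzeroLast? x≢0 w
  ... | inj₂ e = inj₁ (subst (_ ≤_) (trans (sym (+-suc t s)) length)
    (≤-trans via-outer (+-mono-≤ to-outer from-outer)))
    where
    open Exit e
    outer≡0 : ZeroLast outer
    outer≡0 = decidable-stable (zeroLast? outer) outside
    to-outer : altFull x + altFull outer ≤ suc t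
    to-outer = distance-bound-nonzero-zero x≢0 outer≡0 (walk-snoc (within-forget prefix) edge)
    from-outer : altFull outer + altFull y ≤ s
    from-outer = distance-bound-zero-nonzero outer≡0 y≢0 suffix
    via-outer : altFull x + altFull y ≤ (altFull x + altFull outer) + (altFull outer + altFull y)
    via-outer = +-mono-≤ (m≤m+n (altFull x) (altFull outer)) (m≤n+m (altFull y) (altFull outer))
  ... | inj₁ w′ with first-exit (λ v → v last Data.Fin.≟ x last) refl w′
  ...   | inj₁ w″ = ⊥-elim (x≢y (sym (within-target refl w″)))
  ...   | inj₂ e  = inj₂ (subst (_ ≤_) (trans (sym (+-suc t s)) length) (s≤s (+-mono-≤ before after)))
    where
    open Exit e
    zeros : ∀ i → toℕ i < m → Zero inner i × Zero outer i
    zeros with edge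
    ... | inner≢0 , adj , outer≢0 =
      nonzeroLast-move adj inner≢0 outer≢0 λ eq → outside (trans (sym eq) (within-target refl prefix))
    before : altInit x ≤ t
    before = begin
      altInit x         ≤⟨ walk-lipschitz altInit altInit-lipschitz (within-forget prefix) ⟩
      t + altInit inner ≡⟨ cong (t +_) (Init.altPrefix-zero inner (λ i h → proj₁ (zeros i h))) ⟩
      t + 0             ≡⟨ +-identityʳ t ⟩
      t                 ∎
      where open ≤-Reasoning
    after : altInit y ≤ s
    after = begin
      altInit y         ≤⟨ walk-lipschitz altInit altInit-lipschitz (walk-reverse Adj-within-sym suffix) ⟩
      s + altInit outer ≡⟨ cong (s +_) (Init.altPrefix-zero outer (λ i h → proj₂ (zeros i h))) ⟩
      s + 0             ≡⟨ +-identityʳ s ⟩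
      s                 ∎
      where open ≤-Reasoning

  alt-zeroPattern : ∀ x → alt (zeroPattern x) ≡ altFull x
  alt-zeroPattern x = trans (alt-tabulate (suc m) (isZeroB ∘ x))
    (alternations-pointwise (suc m) (pad-cong λ i → cong (isZeroB ∘ x) (sym (inject≤-refl i ≤-refl))))

  alt-zeroPattern-init : ∀ x → alt (zeroPattern (x ∘ inject₁)) ≡ altInit x
  alt-zeroPattern-init x = trans (alt-tabulate m (isZeroB ∘ x ∘ inject₁)) (alternations-pointwise m (pad-cong λ i →
    cong (isZeroB ∘ x) (toℕ-injective (trans (toℕ-inject₁ i) (sym (toℕ-inject≤ i _))))))

  allZero : V
  allZero = fill true

  allZero-zero : ∀ i → Zero allZero i
  allZero-zero i = toℕ-fromℕ< _

  zero-init : V → V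
  zero-init = splice m allZero

  walk-to-allZero : ∀ x → Σ V λ t → Walk Adj x t (altFull x) × t ≈ allZero
  walk-to-allZero x = Full.descend x allZero (λ i _ → allZero-zero i) λ i k≤i → ⊥-elim (<⇒≱ (toℕ<n i) k≤i)

  walk-to-zero-init : ∀ x → Σ V λ t → Walk Adj x t (altInit x) × t ≈ zero-init x
  walk-to-zero-init x = Init.descend x (zero-init x)
    (λ i h → trans (cong toℕ (splice-< m allZero x i h)) (allZero-zero i)) (λ i h → splice-≥ m allZero x i h)

  zero-init-adj : NonZeroLast x → NonZeroLast y → x last ≢ y last → Adj (zero-init x) (zero-init y)
  zero-init-adj {x} {y} x≢0 y≢0 x≢y =
    (last , last-distinct) ,
    inj₂ (inj₂ (last , (λ i h → init-zero x i h , init-zero y i h) ,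
      (λ eq → x≢0 (trans (cong toℕ (sym (at-last x))) eq)) ,
      (λ eq → y≢0 (trans (cong toℕ (sym (at-last y))) eq)) ,
      last-distinct , λ i h → ⊥-elim (<⇒≱ (toℕ<n i) (subst (λ a → suc a ≤ toℕ i) toℕ-last h))))
    where
    at-last : ∀ x → zero-init x last ≡ x last
    at-last x = splice-≥ m allZero x last (≤-reflexive (sym toℕ-last))
    last-distinct : zero-init x last ≢ zero-init y last
    last-distinct eq = x≢y (trans (sym (at-last x)) (trans eq (at-last y)))
    init-zero : ∀ x i → toℕ i < toℕ last → Zero (zero-init x) i
    init-zero x i h = trans (cong toℕ (splice-< m allZero x i (subst (toℕ i <_) toℕ-last h))) (allZero-zero i)

  walk-via-allZero : x last ≢ y last → Walk Adj x y (altFull x + altFull y)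
  walk-via-allZero {x} {y} x≢y with walk-to-allZero x | walk-to-allZero y
  ... | tˣ , wˣ , tˣ≈0 | tʸ , wʸ , tʸ≈0 =
    walk-join ≈-sym Adj-resp (λ eq → x≢y (eq last))
      wˣ (λ i → trans (tˣ≈0 i) (sym (tʸ≈0 i))) (walk-reverse Adj-sym wʸ)

  walk-via-zero-init : NonZeroLast x → NonZeroLast y → x last ≢ y last →
    Walk Adj x y (altInit x + suc (altInit y))
  walk-via-zero-init {x} {y} x≢0 y≢0 x≢y with walk-to-zero-init x | walk-to-zero-init y
  ... | tˣ , wˣ , tˣ≈ | tʸ , wʸ , tʸ≈ = walk-++ wˣ (cons middle (walk-reverse Adj-sym wʸ))
    where
    middle : Adj tˣ tʸ
    middle = proj₁ Adj-resp (≈-sym tʸ≈) (proj₂ Adj-resp (≈-sym tˣ≈) (zero-init-adj x≢0 y≢0 x≢y))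

  distance-zeroLast : x last ≢ y last → ZeroLast x ⊎ ZeroLast y →
    Dist Adj x y (alt (zeroPattern x) + alt (zeroPattern y))
  distance-zeroLast {x} {y} x≢y zero-last rewrite alt-zeroPattern x | alt-zeroPattern y =
    walk-via-allZero x≢y , λ _ → bound zero-last
    where
    bound : ZeroLast x ⊎ ZeroLast y → Walk Adj x y ℓ → altFull x + altFull y ≤ ℓ
    bound (inj₁ x≡0) = distance-bound-zero-nonzero x≡0 λ y≡0 → x≢y (zero-unique x≡0 y≡0)
    bound (inj₂ y≡0) = distance-bound-nonzero-zero (λ x≡0 → x≢y (zero-unique x≡0 y≡0)) y≡0

  distance-nonzeroLast : NonZeroLast x → NonZeroLast y → x last ≢ y last →
    Dist Adj x y ((alt (zeroPattern x) + alt (zeroPattern y))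
                  ⊓ suc (alt (zeroPattern (x ∘ inject₁)) + alt (zeroPattern (y ∘ inject₁))))
  distance-nonzeroLast {x} {y} x≢0 y≢0 x≢y
    rewrite alt-zeroPattern x | alt-zeroPattern y | alt-zeroPattern-init x | alt-zeroPattern-init y =
    walk , λ ℓ w →
      [ ≤-trans (m⊓n≤m _ _) , ≤-trans (m⊓n≤n _ _) ]′ (distance-bound-nonzero x≢0 y≢0 x≢y w)
    where
    walk : Walk Adj x y ((altFull x + altFull y) ⊓ suc (altInit x + altInit y))
    walk with ⊓-sel (altFull x + altFull y) (suc (altInit x + altInit y))
    ... | inj₁ eq = subst (Walk Adj x y) (sym eq) (walk-via-allZero x≢y)
    ... | inj₂ eq = subst (Walk Adj x y) (trans (+-suc _ _) (sym eq)) (walk-via-zero-init x≢0 y≢0 x≢y)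

module _ {m : ℕ} {n : Fin (suc (suc m)) → ℕ} (2≤n : ∀ i → 2 ≤ n i) {x y : Vertex (suc (suc m)) n}
  (x≢y : x (fromℕ (suc m)) ≢ y (fromℕ (suc m)))
  (x≢0 : NonZero' x (fromℕ (suc m))) (y≢0 : NonZero' y (fromℕ (suc m))) where

  open Graph (suc m) (s≤s z≤n) n 2≤n using (distance-nonzeroLast)

  distance-long-uniform-suffixes : 1 < maxUnifSuffixLen (zeroPattern x) → 1 < maxUnifSuffixLen (zeroPattern y) →
    Dist Adj x y (alt (zeroPattern x) + alt (zeroPattern y))
  distance-long-uniform-suffixes longˣ longʸ =
    subst (Dist Adj x y) (m≤n⇒m⊓n≡m (≤-trans (≤-reflexive full≡init) (n≤1+n _)))
      (distance-nonzeroLast x≢0 y≢0 x≢y)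
    where
    full≡init : alt (zeroPattern x) + alt (zeroPattern y)
              ≡ alt (zeroPattern (x ∘ inject₁)) + alt (zeroPattern (y ∘ inject₁))
    full≡init = cong₂ _+_ (alt-long-uniform-suffix x x≢0 longˣ) (alt-long-uniform-suffix y y≢0 longʸ)

  distance-short-uniform-suffix : maxUnifSuffixLen (zeroPattern x) ≡ 1 ⊎ maxUnifSuffixLen (zeroPattern y) ≡ 1 →
    Dist Adj x y (alt (zeroPattern (x ∘ inject₁)) + alt (zeroPattern (y ∘ inject₁)) + 1)
  distance-short-uniform-suffix short =
    subst (Dist Adj x y) (trans (m≥n⇒m⊓n≡n (init<full short)) (+-comm 1 _)) (distance-nonzeroLast x≢0 y≢0 x≢y)
    where
    init<full : maxUnifSuffixLen (zeroPattern x) ≡ 1 ⊎ maxUnifSuffixLen (zeroPattern y) ≡ 1 →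
      suc (alt (zeroPattern (x ∘ inject₁)) + alt (zeroPattern (y ∘ inject₁)))
        ≤ alt (zeroPattern x) + alt (zeroPattern y)
    init<full (inj₁ oneˣ) rewrite alt-short-uniform-suffix x x≢0 oneˣ = +-mono-≤ (n≤1+n _) (alt-init-≤ y y≢0)
    init<full (inj₂ oneʸ) rewrite alt-short-uniform-suffix y y≢0 oneʸ =
      subst (_≤ alt (zeroPattern x) + (2 + alt (zeroPattern (y ∘ inject₁)))) (+-suc _ _)
        (+-mono-≤ (alt-init-≤ x x≢0) (n≤1+n _))

mainTheorem6 : (m : ℕ) → 1 ≤ m → (n : Fin (suc m) → ℕ) → (∀ i → 2 ≤ n i) →
    (x y : Vertex (suc m) n) → x (fromℕ m) ≢ y (fromℕ m) →
    ((toℕ (x (fromℕ m)) ≡ 0 ⊎ toℕ (y (fromℕ m)) ≡ 0) →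
       Dist Adj x y (alt (zeroPattern x) + alt (zeroPattern y)))
    × ((toℕ (x (fromℕ m)) ≢ 0 × toℕ (y (fromℕ m)) ≢ 0 ×
        1 < maxUnifSuffixLen (zeroPattern x) × 1 < maxUnifSuffixLen (zeroPattern y)) →
       Dist Adj x y (alt (zeroPattern x) + alt (zeroPattern y)))
    × ((toℕ (x (fromℕ m)) ≢ 0 × toℕ (y (fromℕ m)) ≢ 0 ×
        (maxUnifSuffixLen (zeroPattern x) ≡ 1 ⊎ maxUnifSuffixLen (zeroPattern y) ≡ 1)) →
       Dist Adj x y (alt (zeroPattern (x ∘ inject₁)) + alt (zeroPattern (y ∘ inject₁)) + 1))
mainTheorem6 (suc m) 1≤m n 2≤n x y x≢y =
  Graph.distance-zeroLast (suc m) 1≤m n 2≤n x≢y ,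
  (λ (x≢0 , y≢0 , longˣ , longʸ) → distance-long-uniform-suffixes 2≤n x≢y x≢0 y≢0 longˣ longʸ) ,
  (λ (x≢0 , y≢0 , short) → distance-short-uniform-suffix 2≤n x≢y x≢0 y≢0 short)
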